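{- Let $G$ be a finite simple undirected graph containing a copy $H$ of the 4-gate as an induced subgraph, with $V(G)\setminus V(H)\neq\emptyset$, such that the edges of $G$ having exactly one endpoint in $V(H)$ are exactly four edges (the external edges), one incident to each of the attachment vertices $1,2,9,11$ of $H$. Then every Hamiltonian cycle $C$ of $G$ contains exactly two of the external edges of $H$; equivalently, once $C$ enters $H$ it visits every vertex of $H$ before exiting, i.e. the edges of $C$ with both endpoints in $V(H)$ form a single path through all vertices of $H$.
   Context: The 4-gate is the simple undirected graph on vertex set $\{1,\dots,11\}$ with the 14 edges $\{1,3\},\{1,8\},\{2,3\},\{2,5\},\{3,4\},\{4,5\},\{4,6\},\{6,7\},\{7,8\},\{7,10\},\{8,9\},\{9,10\},\{10,11\},\{5,11\}$; its attachment vertices are $1,2,9,11$. A Hamiltonian cycle is a cycle passing through every vertex of the graph exactly once. -}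

module Defs where

open import Data.Nat using (ℕ; zero; suc)
open import Data.Fin using (Fin; toℕ)
open import Data.Product using (Σ; ∃; _×_; _,_)
open import Data.Sum using (_⊎_)
open import Relation.Nullary using (¬_)
open import Relation.Binary using (Decidable)
open import Relation.Binary.PropositionalEquality using (_≡_; _≢_)
open import Function.Definitions using (Injective)
open import Function.Bundles using (_⇔_)

record SimpleGraph (n : ℕ) : Set₁ where
  field
    Adj    : Fin n → Fin n → Set
    sym    : ∀ {x y} → Adj x y → Adj y x
    irrefl : ∀ {x} → ¬ Adj x x
    dec    : Decidable Adj

data GateEdge : ℕ → ℕ → Set where
  e1-3   : GateEdge 1 3
  e1-8   : GateEdge 1 8
  e2-3   : GateEdge 2 3
  e2-5   : GateEdge 2 5
  e3-4   : GateEdge 3 4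
  e4-5   : GateEdge 4 5
  e4-6   : GateEdge 4 6
  e6-7   : GateEdge 6 7
  e7-8   : GateEdge 7 8
  e7-10  : GateEdge 7 10
  e8-9   : GateEdge 8 9
  e9-10  : GateEdge 9 10
  e10-11 : GateEdge 10 11
  e5-11  : GateEdge 5 11

label : Fin 11 → ℕ
label i = suc (toℕ i)

GateAdj : Fin 11 → Fin 11 → Set
GateAdj i j = GateEdge (label i) (label j) ⊎ GateEdge (label j) (label i)

-- The attachment vertices 1, 2, 9, 11 (as elements of Fin 11).
attachment : Fin 4 → Fin 11
attachment Fin.zero = Fin.zero
attachment (Fin.suc Fin.zero) = Fin.suc Fin.zero
attachment (Fin.suc (Fin.suc Fin.zero)) = Fin.suc (Fin.suc (Fin.suc (Fin.suc (Fin.suc (Fin.suc (Fin.suc (Fin.suc Fin.zero)))))))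
attachment (Fin.suc (Fin.suc (Fin.suc Fin.zero))) = Fin.suc (Fin.suc (Fin.suc (Fin.suc (Fin.suc (Fin.suc (Fin.suc (Fin.suc (Fin.suc (Fin.suc Fin.zero)))))))))

module _ {n : ℕ} (G : SimpleGraph n) where
  open SimpleGraph G

  InH : (Fin 11 → Fin n) → Fin n → Set
  InH h v = ∃ λ i → h i ≡ v

  record GateCopy : Set where
    field
      h          : Fin 11 → Fin n
      h-inj      : Injective _≡_ _≡_ h
      induced    : ∀ i j → Adj (h i) (h j) ⇔ GateAdj i j
      outside    : ∃ λ v → ¬ InH h v
      ext        : Fin 4 → Fin n
      ext-out    : ∀ k → ¬ InH h (ext k)
      ext-adj    : ∀ k → Adj (h (attachment k)) (ext k)
      ext-only   : ∀ i u → ¬ InH h u → Adj (h i) u →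
                   ∃ λ k → (i ≡ attachment k) × (u ≡ ext k)

-- Hamiltonian cycles: a cyclic ordering c 0, c 1, ..., c (n-1) of all
-- vertices (c injective, hence a bijection), n ≥ 3, with consecutive
-- vertices (cyclically) adjacent.

Next : {n : ℕ} → Fin n → Fin n → Set
Next {n} i j = (suc (toℕ i) ≡ toℕ j) ⊎ ((suc (toℕ i) ≡ n) × (toℕ j ≡ 0))

module _ {n : ℕ} (G : SimpleGraph n) where
  open SimpleGraph G

  record HamiltonianCycle : Set where
    field
      three : 3 Data.Nat.≤ n
      c     : Fin n → Fin n
      c-inj : Injective _≡_ _≡_ c
      c-adj : ∀ i j → Next i j → Adj (c i) (c j)

  CycleEdge : HamiltonianCycle → Fin n → Fin n → Set
  CycleEdge C u v = ∃ λ i → ∃ λ j → Next i j ×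
                     ((c i ≡ u × c j ≡ v) ⊎ (c i ≡ v × c j ≡ u))
    where open HamiltonianCycle C

  UsesExt : GateCopy G → HamiltonianCycle → Fin 4 → Set
  UsesExt H C k = CycleEdge C (GateCopy.h H (attachment k)) (GateCopy.ext H k)

ExactlyTwo : (Fin 4 → Set) → Set
ExactlyTwo P = ∃ λ j → ∃ λ k → j ≢ k × P j × P k × (∀ l → P l → l ≡ j ⊎ l ≡ k)

-- A Hamiltonian cycle meets every vertex in exactly two of its edges.  Since the only edges
-- of G at a gate vertex are its gate edges and, at an attachment vertex, its external edge,
-- the cycle edges at the gate form a set of gate and external edges meeting each of the 11
-- gate vertices exactly twice.  A finite case analysis shows that every such set contains
-- exactly two external edges; no argument excluding subtours is needed.

module Submission where

open import Defs
open import Data.Bool using (Bool; true; false; T; if_then_else_; _∧_; _∨_)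
open import Data.Bool.ListAction using (any)
open import Data.Bool.Properties using (T-∨)
open import Data.Empty using (⊥-elim)
open import Data.Fin using (Fin; zero; suc; toℕ; fromℕ; fromℕ<; punchOut; #_)
open import Data.Fin.Patterns using (0F; 1F; 2F; 3F)
open import Data.Fin.Properties using (toℕ-injective; toℕ<n; toℕ-fromℕ; toℕ-fromℕ<; punchOut-injective; injective⇒≤; any?; _≟_)
open import Data.List using (List; []; _∷_; _++_; map; filter; filterᵇ; allFin; head; fromMaybe)
open import Data.List.Membership.Propositional using (_∈_)
open import Data.List.Membership.Propositional.Properties using (∈-map⁺; ∈-map⁻; ∈-++⁺ˡ; ∈-++⁺ʳ; ∈-filter⁺; ∈-allFin)
open import Data.List.Relation.Unary.Any using (here; there)
open import Data.List.Relation.Unary.All as All using ()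
open import Data.List.Relation.Unary.AllPairs using ([]; _∷_)
open import Data.List.Relation.Unary.Unique.Propositional using (Unique)
open import Data.List.Relation.Unary.Unique.Propositional.Properties as Unique using (allFin⁺)
open import Data.List.Relation.Binary.Pointwise as Pointwise using (Pointwise; []; _∷_)
open import Data.Maybe using (Maybe; just; nothing)
open import Data.Nat as ℕ using (ℕ; suc; _≤_; _≡ᵇ_; _≤ᵇ_; s≤s; z≤n)
open import Data.Nat.Properties using (1+n≰n; m≢1+n+m; ≤-antisym; ≮⇒≥; ≤-refl; <-trans; suc-injective; <-irrefl; <⇒≱)
open import Data.Product using (∃; ∃₂; _×_; _,_)
open import Data.Sum as Sum using (_⊎_; inj₁; inj₂; [_,_])
open import Function using (_∘_; id)
open import Function.Bundles using (_⇔_; mk⇔; Equivalence)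
open import Function.Definitions using (Injective)
open import Relation.Nullary using (¬_; does; proof; yes; no)
open import Relation.Nullary.Decidable using (map′; _⊎-dec_; T?)
open import Relation.Nullary.Reflects using (Reflects; ofʸ; ofⁿ)
open import Relation.Binary using (Decidable)
open import Relation.Binary.PropositionalEquality using (_≡_; _≢_; refl; sym; trans; cong; subst)

data TrueCount : ℕ → List Bool → Set where
  []      : TrueCount 0 []
  true∷_  : ∀ {k bs} → TrueCount k bs → TrueCount (suc k) (true ∷ bs)
  false∷_ : ∀ {k bs} → TrueCount k bs → TrueCount k (false ∷ bs)

module _ {V : Set} where

  Marks : (V → Set) → List V → List Bool → Set
  Marks P = Pointwise (λ w b → Reflects (P w) b)

  ∈-tail : ∀ {w z} {ws : List V} → w ≢ z → z ∈ w ∷ ws → z ∈ ws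
  ∈-tail w≢z (here refl) = ⊥-elim (w≢z refl)
  ∈-tail w≢z (there z∈ws) = z∈ws

  module _ {P : V → Set} where

    trueCount-none : ∀ {ws bs} → Marks P ws bs → (∀ {w} → w ∈ ws → ¬ P w) → TrueCount 0 bs
    trueCount-none []            ¬P = []
    trueCount-none (ofʸ p ∷ _)   ¬P = ⊥-elim (¬P (here refl) p)
    trueCount-none (ofⁿ _ ∷ rs)  ¬P = false∷ trueCount-none rs (¬P ∘ there)

    trueCount-one : ∀ {ws bs x} → Unique ws → Marks P ws bs → x ∈ ws → P x →
                    (∀ {w} → w ∈ ws → P w → w ≡ x) → TrueCount 1 bs
    trueCount-one (w∉ws ∷ _) (ofʸ p ∷ rs) _ _ only with only (here refl) p
    ... | refl = true∷ trueCount-none rs λ w′∈ws pw′ →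
                   All.lookup w∉ws w′∈ws (sym (only (there w′∈ws) pw′))
    trueCount-one (_ ∷ u) (ofⁿ ¬p ∷ rs) x∈ px only =
      false∷ trueCount-one u rs (∈-tail (λ { refl → ¬p px }) x∈) px (only ∘ there)

    trueCount-two : ∀ {ws bs x y} → Unique ws → Marks P ws bs → x ∈ ws → y ∈ ws → x ≢ y →
                    P x → P y → (∀ {w} → w ∈ ws → P w → w ≡ x ⊎ w ≡ y) → TrueCount 2 bs
    trueCount-two (w∉ws ∷ u) (ofʸ p ∷ rs) x∈ y∈ x≢y px py only with only (here refl) p
    ... | inj₁ refl = true∷ trueCount-one u rs (∈-tail x≢y y∈) py λ w′∈ws pw′ →
                        [ (λ w′≡w → ⊥-elim (All.lookup w∉ws w′∈ws (sym w′≡w))) , id ] (only (there w′∈ws) pw′)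
    ... | inj₂ refl = true∷ trueCount-one u rs (∈-tail (x≢y ∘ sym) x∈) px λ w′∈ws pw′ →
                        [ id , (λ w′≡w → ⊥-elim (All.lookup w∉ws w′∈ws (sym w′≡w))) ] (only (there w′∈ws) pw′)
    trueCount-two (_ ∷ u) (ofⁿ ¬p ∷ rs) x∈ y∈ x≢y px py only =
      false∷ trueCount-two u rs (∈-tail (λ { refl → ¬p px }) x∈) (∈-tail (λ { refl → ¬p py }) y∈)
                           x≢y px py (only ∘ there)

injective⇒surjective : ∀ {n} {f : Fin n → Fin n} → Injective _≡_ _≡_ f → ∀ y → ∃ λ x → f x ≡ y
injective⇒surjective {suc m} {f} f-inj y with any? (λ x → f x ≟ y)
... | yes hit  = hit
... | no ¬hit = ⊥-elim (1+n≰n (injective⇒≤ g-inj))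
  where
  -- Missing y, f squeezes Fin (suc m) injectively into Fin m.
  g : Fin (suc m) → Fin m
  g x = punchOut (λ y≡fx → ¬hit (x , sym y≡fx))
  g-inj : Injective _≡_ _≡_ g
  g-inj = f-inj ∘ punchOut-injective {i = y} _ _

Next-functional : ∀ {n} {i j j′ : Fin n} → Next i j → Next i j′ → j ≡ j′
Next-functional (inj₁ i→j) (inj₁ i→j′) = toℕ-injective (trans (sym i→j) i→j′)
Next-functional {j = j} (inj₁ i→j) (inj₂ (i-last , _)) = ⊥-elim (<-irrefl (trans (sym i→j) i-last) (toℕ<n j))
Next-functional {j′ = j′} (inj₂ (i-last , _)) (inj₁ i→j′) = ⊥-elim (<-irrefl (trans (sym i→j′) i-last) (toℕ<n j′))
Next-functional (inj₂ (_ , j≡0)) (inj₂ (_ , j′≡0)) = toℕ-injective (trans j≡0 (sym j′≡0))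

Next-injective : ∀ {n} {i i′ j : Fin n} → Next i j → Next i′ j → i ≡ i′
Next-injective (inj₁ i→j) (inj₁ i′→j) = toℕ-injective (suc-injective (trans i→j (sym i′→j)))
Next-injective (inj₁ i→j) (inj₂ (_ , j≡0)) with () ← trans i→j j≡0
Next-injective (inj₂ (_ , j≡0)) (inj₁ i′→j) with () ← trans i′→j j≡0
Next-injective (inj₂ (i-last , _)) (inj₂ (i′-last , _)) = toℕ-injective (suc-injective (trans i-last (sym i′-last)))

next : ∀ {n} (i : Fin n) → ∃ (Next i)
next {suc m} i with suc (toℕ i) ℕ.<? suc m
... | yes i<m = fromℕ< i<m , inj₁ (sym (toℕ-fromℕ< i<m))
... | no  i≮m = zero , inj₂ (≤-antisym (toℕ<n i) (≮⇒≥ i≮m) , refl)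

prev : ∀ {n} (j : Fin n) → ∃ λ i → Next i j
prev {suc m} zero    = fromℕ m , inj₂ (cong suc (toℕ-fromℕ m) , refl)
prev {suc m} (suc j) = fromℕ< (<-trans (toℕ<n j) ≤-refl) , inj₁ (cong suc (toℕ-fromℕ< _))

Next-asym : ∀ {n} → 3 ≤ n → {i j : Fin n} → Next i j → ¬ Next j i
Next-asym _ {i} (inj₁ i→j) (inj₁ j→i) = m≢1+n+m (toℕ i) (sym (trans (cong suc i→j) j→i))
Next-asym 3≤n (inj₁ i→j) (inj₂ (j-last , i≡0)) =
  <⇒≱ (subst (ℕ._< 3) (trans (cong suc (trans (sym (cong suc i≡0)) i→j)) j-last) ≤-refl) 3≤n
Next-asym 3≤n (inj₂ (i-last , j≡0)) (inj₁ j→i) =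
  <⇒≱ (subst (ℕ._< 3) (trans (cong suc (trans (sym (cong suc j≡0)) j→i)) i-last) ≤-refl) 3≤n
Next-asym 3≤n (inj₂ (i-last , _)) (inj₂ (_ , i≡0)) =
  <⇒≱ (subst (ℕ._< 3) (trans (sym (cong suc i≡0)) i-last) (s≤s (s≤s z≤n))) 3≤n

module _ {n : ℕ} {G : SimpleGraph n} (C : HamiltonianCycle G) where
  open SimpleGraph G using (Adj)
  open HamiltonianCycle C

  cycleEdge-sym : ∀ {u v} → CycleEdge G C u v → CycleEdge G C v u
  cycleEdge-sym (i , j , i→j , inj₁ uv) = i , j , i→j , inj₂ uv
  cycleEdge-sym (i , j , i→j , inj₂ vu) = i , j , i→j , inj₁ vu

  cycleEdge⇒adj : ∀ {u v} → CycleEdge G C u v → Adj u v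
  cycleEdge⇒adj (i , j , i→j , inj₁ (refl , refl)) = c-adj i j i→j
  cycleEdge⇒adj (i , j , i→j , inj₂ (refl , refl)) = SimpleGraph.sym G (c-adj i j i→j)

  -- a and b are the successor and predecessor of u on the cycle, distinct because n ≥ 3.
  cycleNeighbours : ∀ u → ∃₂ λ a b → a ≢ b × (∀ v → CycleEdge G C u v ⇔ (v ≡ a ⊎ v ≡ b))
  cycleNeighbours u with p , refl ← injective⇒surjective c-inj u = around p (next p) (prev p)
    where
    around : ∀ p → ∃ (Next p) → ∃ (λ o → Next o p) →
             ∃₂ λ a b → a ≢ b × (∀ v → CycleEdge G C (c p) v ⇔ (v ≡ a ⊎ v ≡ b))
    around p (q , p→q) (o , o→p) =
      c q , c o , (λ cq≡co → Next-asym three o→p (subst (Next p) (c-inj cq≡co) p→q)) , λ _ → mk⇔ to from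
      where
      to : ∀ {v} → CycleEdge G C (c p) v → v ≡ c q ⊎ v ≡ c o
      to (i , j , i→j , inj₁ (ci≡cp , cj≡v)) with refl ← c-inj ci≡cp =
        inj₁ (trans (sym cj≡v) (cong c (Next-functional i→j p→q)))
      to (i , j , i→j , inj₂ (ci≡v , cj≡cp)) with refl ← c-inj cj≡cp =
        inj₂ (trans (sym ci≡v) (cong c (Next-injective i→j o→p)))
      from : ∀ {v} → v ≡ c q ⊎ v ≡ c o → CycleEdge G C (c p) v
      from (inj₁ refl) = p , q , p→q , inj₁ (refl , refl)
      from (inj₂ refl) = o , p , o→p , inj₂ (refl , refl)

  cycleEdge? : Decidable (CycleEdge G C)
  cycleEdge? u v with a , b , _ , nbr ← cycleNeighbours u =
    map′ (Equivalence.from (nbr v)) (Equivalence.to (nbr v)) (v ≟ a ⊎-dec v ≟ b)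

  cycle-trueCount : ∀ {u ws bs} → Unique ws → (∀ v → Adj u v → v ∈ ws) →
                    Marks (CycleEdge G C u) ws bs → TrueCount 2 bs
  cycle-trueCount {u} uniq cover marks with a , b , a≢b , nbr ← cycleNeighbours u =
    trueCount-two uniq marks (cover a (cycleEdge⇒adj ua)) (cover b (cycleEdge⇒adj ub)) a≢b ua ub
                  (λ _ → Equivalence.to (nbr _))
    where
    ua = Equivalence.from (nbr a) (inj₁ refl)
    ub = Equivalence.from (nbr b) (inj₂ refl)

data TwoOfThree : Bool → Bool → Bool → Set where
  ttf : TwoOfThree true true false
  tft : TwoOfThree true false true
  ftt : TwoOfThree false true true

twoOfThree : ∀ {a b c} → TrueCount 2 (a ∷ b ∷ c ∷ []) → TwoOfThree a b c
twoOfThree (true∷ true∷ false∷ []) = ttf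
twoOfThree (true∷ false∷ true∷ []) = tft
twoOfThree (false∷ true∷ true∷ []) = ftt
twoOfThree (false∷ false∷ true∷ ())
twoOfThree (false∷ false∷ false∷ ())

bothTrue : ∀ {a b} → TrueCount 2 (a ∷ b ∷ []) → a ≡ true × b ≡ true
bothTrue (true∷ true∷ []) = refl , refl
bothTrue (false∷ true∷ ())
bothTrue (false∷ false∷ ())

pattern ttff = true∷ true∷ false∷ false∷ []
pattern tftf = true∷ false∷ true∷ false∷ []
pattern tfft = true∷ false∷ false∷ true∷ []
pattern fttf = false∷ true∷ true∷ false∷ []
pattern ftft = false∷ true∷ false∷ true∷ []
pattern fftt = false∷ false∷ true∷ true∷ []

-- e‹a›-‹b› marks the gate edge {a, b} and x‹a› the external edge at attachment vertex a;
-- the a-th hypothesis says that exactly two edges at vertex a are marked.  The 14 clauses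
-- are all solutions: none of them marks 0 or 4 external edges.
twoExternalEdges :
  ∀ {e1-3 e1-8 e2-3 e2-5 e3-4 e4-5 e4-6 e6-7 e7-8 e7-10 e8-9 e9-10 e10-11 e5-11 x1 x2 x9 x11} →
  TwoOfThree e1-3 e1-8 x1 →
  TwoOfThree e2-3 e2-5 x2 →
  TwoOfThree e1-3 e2-3 e3-4 →
  TwoOfThree e3-4 e4-5 e4-6 →
  TwoOfThree e2-5 e4-5 e5-11 →
  e4-6 ≡ true × e6-7 ≡ true →
  TwoOfThree e6-7 e7-8 e7-10 →
  TwoOfThree e1-8 e7-8 e8-9 →
  TwoOfThree e8-9 e9-10 x9 →
  TwoOfThree e7-10 e9-10 e10-11 →
  TwoOfThree e5-11 e10-11 x11 →
  TrueCount 2 (x1 ∷ x2 ∷ x9 ∷ x11 ∷ [])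
twoExternalEdges ftt ttf ftt tft tft (refl , refl) tft tft tft tft ttf = tftf
twoExternalEdges ftt ttf ftt tft tft (refl , refl) tft tft ttf ttf tft = tfft
twoExternalEdges ftt ttf ftt tft tft (refl , refl) ttf ttf ftt ftt ttf = tftf
twoExternalEdges tft ftt tft tft tft (refl , refl) ttf ftt ttf ftt ttf = ttff
twoExternalEdges tft tft ttf ftt ftt (refl , refl) ttf ftt ttf ftt ttf = ttff
twoExternalEdges tft ttf ttf ftt ttf (refl , refl) ttf ftt ttf ftt ftt = tfft
twoExternalEdges ttf ftt tft tft tft (refl , refl) tft tft tft tft ttf = fttf
twoExternalEdges ttf ftt tft tft tft (refl , refl) tft tft ttf ttf tft = ftft
twoExternalEdges ttf ftt tft tft tft (refl , refl) ttf ttf ftt ftt ttf = fttf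
twoExternalEdges ttf tft ttf ftt ftt (refl , refl) tft tft tft tft ttf = fttf
twoExternalEdges ttf tft ttf ftt ftt (refl , refl) tft tft ttf ttf tft = ftft
twoExternalEdges ttf tft ttf ftt ftt (refl , refl) ttf ttf ftt ftt ttf = fttf
twoExternalEdges ttf ttf ttf ftt ttf (refl , refl) tft tft tft tft ftt = fftt
twoExternalEdges ttf ttf ttf ftt ttf (refl , refl) ttf ttf ftt ftt ftt = fftt

exactlyTwo-reflects : ∀ {P : Fin 4 → Set} {b : Fin 4 → Bool} →
                      (∀ k → Reflects (P k) (b k)) → TrueCount 2 (map b (allFin 4)) → ExactlyTwo P
exactlyTwo-reflects {P} r t = pick t (r 0F) (r 1F) (r 2F) (r 3F)
  where
  pick : ∀ {b₀ b₁ b₂ b₃} → TrueCount 2 (b₀ ∷ b₁ ∷ b₂ ∷ b₃ ∷ []) →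
         Reflects (P 0F) b₀ → Reflects (P 1F) b₁ → Reflects (P 2F) b₂ → Reflects (P 3F) b₃ → ExactlyTwo P
  pick ttff (ofʸ p₀) (ofʸ p₁) (ofⁿ ¬p₂) (ofⁿ ¬p₃) = 0F , 1F , (λ ()) , p₀ , p₁ , λ
    { 0F _ → inj₁ refl ; 1F _ → inj₂ refl ; 2F p₂ → ⊥-elim (¬p₂ p₂) ; 3F p₃ → ⊥-elim (¬p₃ p₃) }
  pick tftf (ofʸ p₀) (ofⁿ ¬p₁) (ofʸ p₂) (ofⁿ ¬p₃) = 0F , 2F , (λ ()) , p₀ , p₂ , λ
    { 0F _ → inj₁ refl ; 1F p₁ → ⊥-elim (¬p₁ p₁) ; 2F _ → inj₂ refl ; 3F p₃ → ⊥-elim (¬p₃ p₃) }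
  pick tfft (ofʸ p₀) (ofⁿ ¬p₁) (ofⁿ ¬p₂) (ofʸ p₃) = 0F , 3F , (λ ()) , p₀ , p₃ , λ
    { 0F _ → inj₁ refl ; 1F p₁ → ⊥-elim (¬p₁ p₁) ; 2F p₂ → ⊥-elim (¬p₂ p₂) ; 3F _ → inj₂ refl }
  pick fttf (ofⁿ ¬p₀) (ofʸ p₁) (ofʸ p₂) (ofⁿ ¬p₃) = 1F , 2F , (λ ()) , p₁ , p₂ , λ
    { 0F p₀ → ⊥-elim (¬p₀ p₀) ; 1F _ → inj₁ refl ; 2F _ → inj₂ refl ; 3F p₃ → ⊥-elim (¬p₃ p₃) }
  pick ftft (ofⁿ ¬p₀) (ofʸ p₁) (ofⁿ ¬p₂) (ofʸ p₃) = 1F , 3F , (λ ()) , p₁ , p₃ , λ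
    { 0F p₀ → ⊥-elim (¬p₀ p₀) ; 1F _ → inj₁ refl ; 2F p₂ → ⊥-elim (¬p₂ p₂) ; 3F _ → inj₂ refl }
  pick fftt (ofⁿ ¬p₀) (ofⁿ ¬p₁) (ofʸ p₂) (ofʸ p₃) = 2F , 3F , (λ ()) , p₂ , p₃ , λ
    { 0F p₀ → ⊥-elim (¬p₀ p₀) ; 1F p₁ → ⊥-elim (¬p₁ p₁) ; 2F _ → inj₁ refl ; 3F _ → inj₂ refl }
  pick (false∷ false∷ false∷ true∷ ())
  pick (false∷ false∷ false∷ false∷ ())

gateEdges : List (ℕ × ℕ)
gateEdges = (1 , 3) ∷ (1 , 8) ∷ (2 , 3) ∷ (2 , 5) ∷ (3 , 4) ∷ (4 , 5) ∷ (4 , 6) ∷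
            (6 , 7) ∷ (7 , 8) ∷ (7 , 10) ∷ (8 , 9) ∷ (9 , 10) ∷ (10 , 11) ∷ (5 , 11) ∷ []

isGateEdge : ℕ → ℕ → Bool
isGateEdge m n = any (λ (a , b) → (m ≡ᵇ a) ∧ (n ≡ᵇ b)) gateEdges

gateEdge⇒isGateEdge : ∀ {m n} → GateEdge m n → T (isGateEdge m n)
gateEdge⇒isGateEdge = λ
  { e1-3 → _ ; e1-8 → _ ; e2-3 → _ ; e2-5 → _ ; e3-4 → _ ; e4-5 → _ ; e4-6 → _
  ; e6-7 → _ ; e7-8 → _ ; e7-10 → _ ; e8-9 → _ ; e9-10 → _ ; e10-11 → _ ; e5-11 → _ }

isGateAdj : Fin 11 → Fin 11 → Bool
isGateAdj i j = isGateEdge (label i) (label j) ∨ isGateEdge (label j) (label i)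

-- In increasing order, so that the degree constraints below compute to the shape twoExternalEdges expects.
gateNeighbours : Fin 11 → List (Fin 11)
gateNeighbours i = filterᵇ (isGateAdj i) (allFin 11)

gateAdj⇒∈gateNeighbours : ∀ {i j} → GateAdj i j → j ∈ gateNeighbours i
gateAdj⇒∈gateNeighbours {i} {j} adj =
  ∈-filter⁺ (T? ∘ isGateAdj i) (∈-allFin j)
    (Equivalence.from T-∨ (Sum.map gateEdge⇒isGateEdge gateEdge⇒isGateEdge adj))

attachmentIndex : Fin 11 → Maybe (Fin 4)
attachmentIndex i = head (filter (λ k → attachment k ≟ i) (allFin 4))

attachmentIndex-attachment : ∀ k → attachmentIndex (attachment k) ≡ just k
attachmentIndex-attachment 0F = refl
attachmentIndex-attachment 1F = refl
attachmentIndex-attachment 2F = refl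
attachmentIndex-attachment 3F = refl

module _ {n : ℕ} {G : SimpleGraph n} (H : GateCopy G) (C : HamiltonianCycle G) where
  open SimpleGraph G using (Adj)
  open GateCopy H

  uses : Fin n → Fin n → Bool
  uses u v = does (cycleEdge? C u v)

  -- Each gate edge is read off in the orientation of its smaller endpoint, so that both
  -- endpoints see the same boolean.
  gateUses : Fin 11 → Fin 11 → Bool
  gateUses i j = if toℕ i ≤ᵇ toℕ j then uses (h i) (h j) else uses (h j) (h i)

  gateUses-reflects : ∀ i j → Reflects (CycleEdge G C (h i) (h j)) (gateUses i j)
  gateUses-reflects i j with toℕ i ≤ᵇ toℕ j
  ... | true  = proof (cycleEdge? C (h i) (h j))
  ... | false = proof (map′ (cycleEdge-sym C) (cycleEdge-sym C) (cycleEdge? C (h j) (h i)))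

  externalIndices : Fin 11 → List (Fin 4)
  externalIndices i = fromMaybe (attachmentIndex i)

  incident : Fin 11 → List (Fin n)
  incident i = map h (gateNeighbours i) ++ map ext (externalIndices i)

  incidentUses : Fin 11 → List Bool
  incidentUses i = map (gateUses i) (gateNeighbours i) ++ map (uses (h i) ∘ ext) (externalIndices i)

  incident-unique : ∀ i → Unique (incident i)
  incident-unique i = Unique.++⁺ (Unique.map⁺ h-inj (Unique.filter⁺ (T? ∘ isGateAdj i) (allFin⁺ 11)))
                                 (external-unique (attachmentIndex i)) disjoint
    where
    external-unique : ∀ m → Unique (map ext (fromMaybe m))
    external-unique nothing  = []
    external-unique (just _) = All.[] ∷ []
    disjoint : ∀ {v} → ¬ (v ∈ map h (gateNeighbours i) × v ∈ map ext (externalIndices i))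
    disjoint (v∈h , v∈ext) with j , _ , refl ← ∈-map⁻ h v∈h | k , _ , hj≡ek ← ∈-map⁻ ext v∈ext =
      ext-out k (j , hj≡ek)

  incident-covers : ∀ i v → Adj (h i) v → v ∈ incident i
  incident-covers i v adj with any? (λ j → h j ≟ v)
  ... | yes (j , refl) =
    ∈-++⁺ˡ (∈-map⁺ h (gateAdj⇒∈gateNeighbours (Equivalence.to (induced i j) adj)))
  ... | no v∉H with ext-only i v v∉H adj
  ...   | k , refl , refl rewrite attachmentIndex-attachment k =
    ∈-++⁺ʳ (map h (gateNeighbours (attachment k))) (here refl)

  incident-marks : ∀ i → Marks (CycleEdge G C (h i)) (incident i) (incidentUses i)
  incident-marks i = Pointwise.++⁺
    (Pointwise.map⁺ h (gateUses i) (Pointwise.refl (gateUses-reflects i _) {gateNeighbours i}))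
    (Pointwise.map⁺ ext (uses (h i) ∘ ext) (Pointwise.refl (proof (cycleEdge? C (h i) (ext _))) {externalIndices i}))

  incident-trueCount : ∀ i → TrueCount 2 (incidentUses i)
  incident-trueCount i = cycle-trueCount C (incident-unique i) (incident-covers i) (incident-marks i)

proposition3p2 : ∀ {n : ℕ} (G : SimpleGraph n) (H : GateCopy G) (C : HamiltonianCycle G) →
                 ExactlyTwo (UsesExt G H C)
proposition3p2 G H C =
  exactlyTwo-reflects (λ k → proof (cycleEdge? C (h (attachment k)) (ext k)))
    (twoExternalEdges
      (twoOfThree (degree (# 0))) (twoOfThree (degree (# 1))) (twoOfThree (degree (# 2)))
      (twoOfThree (degree (# 3))) (twoOfThree (degree (# 4))) (bothTrue (degree (# 5)))
      (twoOfThree (degree (# 6))) (twoOfThree (degree (# 7))) (twoOfThree (degree (# 8)))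
      (twoOfThree (degree (# 9))) (twoOfThree (degree (# 10))))
  where
  open GateCopy H
  degree : ∀ i → TrueCount 2 (incidentUses H C i)
  degree = incident-trueCount H C
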